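{- Let $r\ge3$ be an integer, let $m$ and $n\le (r-1)m$ be nonnegative integers, let $G$ be an $n$-vertex graph and $M\subset V(G)$ with $|M|=m$ such that no copy of $K_r$ in $G$ uses vertices of $M$. Suppose that there are sets $P_1,\dots,P_k\subset V(G)$ of sizes $p_1,\dots,p_k$ such that for all $i\in[k]$: (i) $|P_i|\ge r$; (ii) $P_i$ is the vertex set of a maximum clique in $G\big[V(G)\setminus\bigcup_{j=1}^{i-1}P_j\big]$; (iii) $G\big[V(G)\setminus\bigcup_{j=1}^{k}P_j\big]$ contains no $K_r$. Let $p:=\sum_{\ell=1}^k p_\ell$. Then $$e(G)\le t_{r-1}(n)-\sum_{i=1}^k\sum_{j=0}^{p_i-r}\Big(m-\Big\lfloor\frac{n-\big(p-j-\sum_{\ell=i+1}^{k}p_\ell\big)}{r-1}\Big\rfloor-1\Big).$$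
   Context: $t_{r-1}(n)$ denotes the number of edges of the Turán graph $T_{r-1}(n)$, the complete $(r-1)$-partite graph on $n$ vertices with part sizes differing by at most one. -}

module Defs where

open import Data.Nat using (ℕ; zero; suc; _+_; _∸_; _<ᵇ_; _<_; _≤_; _≡ᵇ_)
open import Data.Product using (_×_; ∃)
open import Data.Nat.DivMod using (_%_; _/_)
open import Data.Bool using (Bool; true; false; if_then_else_; _∧_; not)
open import Data.Fin using (Fin; toℕ)
open import Data.Fin.Subset using (Subset; _∈_; _∉_; ∣_∣)
open import Data.List using (List; map; allFin; upTo)
open import Data.Nat.ListAction using (sum)
open import Data.Integer as ℤ using (ℤ; +_)
open import Relation.Binary.PropositionalEquality using (_≡_; _≢_)
open import Relation.Nullary using (¬_)

record Graph (n : ℕ) : Set where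
  field
    adj   : Fin n → Fin n → Bool
    sym   : ∀ u v → adj u v ≡ adj v u
    irrefl : ∀ u → adj u u ≡ false
open Graph public

e : {n : ℕ} → Graph n → ℕ
e {n} G = sum (map (λ u → sum (map (λ v →
  if (toℕ u <ᵇ toℕ v) ∧ adj G u v then 1 else 0) (allFin n))) (allFin n))

-- Turán graph T_q(n) on Fin n: vertex v lies in part (toℕ v mod q); parts
-- then have sizes differing by at most one; u ~ v iff in different parts.
-- turan q n = t_q(n) = e(T_q(n)).  (Convention: turan 0 n = 0; unused since r ≥ 3.)
turan : ℕ → ℕ → ℕ
turan zero n = 0
turan (suc q) n = sum (map (λ u → sum (map (λ v →
  if (u <ᵇ v) ∧ not (samePart u v) then 1 else 0) (upTo n))) (upTo n))
  where
  samePart : ℕ → ℕ → Bool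
  samePart u v = _≡ᵇ_ (u % suc q) (v % suc q)

fdiv : ℕ → ℕ → ℕ
fdiv x zero = 0
fdiv x (suc q) = x / suc q

IsClique : {n : ℕ} → Graph n → Subset n → Set
IsClique G S = ∀ u v → u ∈ S → v ∈ S → u ≢ v → adj G u v ≡ true

InsideP : {n : ℕ} → (Fin n → Set) → Subset n → Set
InsideP W S = ∀ v → v ∈ S → W v

IsMaxCliqueIn : {n : ℕ} → Graph n → (Fin n → Set) → Subset n → Set
IsMaxCliqueIn G W S =
  IsClique G S × InsideP W S × (∀ T → IsClique G T → InsideP W T → ∣ T ∣ ≤ ∣ S ∣)

-- v ∉ P_1 ∪ … ∪ P_{i-1}  (0-based: v not in P j for j < i)
NotInEarlier : {n k : ℕ} → (Fin k → Subset n) → Fin k → Fin n → Set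
NotInEarlier P i v = ∀ j → toℕ j < toℕ i → v ∉ P j

NotInAny : {n k : ℕ} → (Fin k → Subset n) → Fin n → Set
NotInAny P v = ∀ j → v ∉ P j

HasKrIn : {n : ℕ} → Graph n → ℕ → (Fin n → Set) → Set
HasKrIn G r W = ∃ λ T → IsClique G T × InsideP W T × ∣ T ∣ ≡ r

KrMeets : {n : ℕ} → Graph n → ℕ → Subset n → Set
KrMeets G r M = ∃ λ T → IsClique G T × ∣ T ∣ ≡ r × ∃ λ v → v ∈ T × v ∈ M

totalSize : {n k : ℕ} → (Fin k → Subset n) → ℕ
totalSize {k = k} P = sum (map (λ l → ∣ P l ∣) (allFin k))

tailSize : {n k : ℕ} → (Fin k → Subset n) → Fin k → ℕ
tailSize {k = k} P i = sum (map (λ l → if toℕ i <ᵇ toℕ l then ∣ P l ∣ else 0) (allFin k))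

deficit : (n m r k : ℕ) → (Fin k → Subset n) → ℤ
deficit n m r k P = sumℤ (map (λ i →
    sumℤ (map (λ j →
      ((+ m) ℤ.- (+ fdiv (n ∸ (totalSize P ∸ j ∸ tailSize P i)) (r ∸ 1))) ℤ.- (+ 1))
      (upTo (suc (∣ P i ∣ ∸ r)))))
  (allFin k))
  where
  sumℤ : List ℤ → ℤ
  sumℤ = Data.List.foldr ℤ._+_ (+ 0)

module Submission where

-- Peel off the maximum cliques P₁, …, P_k one at a time. Removing a maximum
-- clique Q of size s from the current vertex set W loses the s(s−1)/2 edges
-- inside Q and at most s − 1 edges from each remaining vertex into Q (its
-- neighbours in Q and the vertex itself form a clique, no larger than Q). A
-- vertex of M lies in no K_r, so it avoids Q (|Q| ≥ r) and has at most r − 2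
-- neighbours in it. With q = r − 1 the Turán numbers satisfy
--   t_q(N + s) = t_q(N) + s(s−1)/2 + (s−1)N − Σ_{j < s−q} (⌊(N + j)/q⌋ + 1)  (s ≥ q),
--   t_q(N + s) ≥ t_q(N) + s(s−1)/2 + (s−1)N                                 (s ≤ q),
-- both consequences of t_q(N + 1) = t_q(N) + N − ⌊N/q⌋ and Hermite's identity
-- Σ_{j < q} ⌊(x + j)/q⌋ = x. Hence every peeled clique accounts for one block
-- of the deficit, and on the K_r-free remainder Turán's theorem, proved by the
-- same clique-removal induction with the second estimate, finishes the bound.

open import Data.Bool using (Bool; true; false; _∧_; _∨_; not; if_then_else_)
open import Data.Bool.Properties using (∧-zeroʳ; ∧-identityʳ) renaming (_≟_ to _≟ᵇ_)
open import Data.Nat hiding (_≟_)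
open import Data.Nat.Properties hiding (_≟_)
open import Data.Nat.DivMod
open import Data.Nat.ListAction using () renaming (sum to sumᴸ)
open import Data.Nat.Tactic.RingSolver using (solve-∀)
open import Data.Integer as ℤ using (ℤ)
open import Data.Integer.Properties as ℤ using (pos-+)
import Data.Integer.Tactic.RingSolver as ℤ-Solver
open import Data.Fin using (Fin; zero; suc; toℕ; _≟_)
open import Data.Fin.Properties using (toℕ<n; toℕ-injective; all?)
open import Data.Fin.Subset
  using (Subset; _∈_; _∉_; _⊆_; _⊂_; ∣_∣; _∩_; _∪_; _─_; ⁅_⁆; ⊤; ⊥; Nonempty; Empty; inside; outside)
open import Data.Fin.Subset.Properties
  using (_∈?_; nonempty?; Empty-unique; x∈⁅x⁆; x∈⁅y⁆⇒x≡y; x≢y⇒x∉⁅y⁆; ∣⁅x⁆∣≡1; ⊥⊆; ∉⊥; ∣⊥∣≡0; ∈⊤; ⊆⊤; ∣⊤∣≡n;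
         s⊆s; ⊆-trans; p⊆q⇒∣p∣≤∣q∣; x∈p∪q⁻; x∈p∪q⁺; x∈p∩q⁺; p∩q⊆p; p∩q⊆q; x∈p∧x∉q⇒x∈p─q; p─q⊆p; p∩q≢∅⇒p─q⊂p)
open import Data.Fin.Subset.Induction using (⊂-wellFounded; Acc; acc)
open import Data.Vec using ([]; _∷_; lookup; tabulate)
open import Data.Vec.Properties using (lookup∘tabulate; lookup-zipWith; []=⇒lookup; lookup⇒[]=)
open import Data.List as List using (List; map; applyUpTo; upTo; allFin)
open import Data.Product using (_×_; _,_; proj₁; proj₂; ∃)
open import Data.Sum using (_⊎_; inj₁; inj₂)
open import Function using (_∘_)
open import Relation.Nullary using (¬_; Dec; yes; no; contradiction; ¬?; _×-dec_; _→-dec_)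
open import Relation.Binary.PropositionalEquality
open import Relation.Binary.Definitions using (tri<; tri≈; tri>)
open import Algebra.Properties.Semiring.Sum +-*-semiring
  using (sum-syntax; sum-cong-≗; ∑-distrib-+; ∑-comm; *-distribˡ-sum; *-distribʳ-sum; sum-replicate-zero)

open import Defs renaming (sym to adj-sym; irrefl to adj-irrefl)

⟦_⟧ : Bool → ℕ
⟦ b ⟧ = if b then 1 else 0

∑-mono-≤ : ∀ {k} {f g : Fin k → ℕ} → (∀ i → f i ≤ g i) → ∑[ i < k ] f i ≤ ∑[ i < k ] g i
∑-mono-≤ {zero}  f≤g = z≤n
∑-mono-≤ {suc k} f≤g = +-mono-≤ (f≤g zero) (∑-mono-≤ (f≤g ∘ suc))

∑-const : ∀ k c → ∑[ i < k ] c ≡ k * c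
∑-const zero    c = refl
∑-const (suc k) c = cong (c +_) (∑-const k c)

∑-zero : ∀ {k} {f : Fin k → ℕ} → (∀ i → f i ≡ 0) → ∑[ i < k ] f i ≡ 0
∑-zero {k} f≗0 = trans (sum-cong-≗ f≗0) (sum-replicate-zero k)

∑-split : ∀ a b (f : ℕ → ℕ) →
  ∑[ j < a + b ] f (toℕ j) ≡ ∑[ j < a ] f (toℕ j) + ∑[ j < b ] f (a + toℕ j)
∑-split zero    b f = refl
∑-split (suc a) b f = trans (cong (f 0 +_) (∑-split a b (f ∘ suc))) (sym (+-assoc (f 0) _ _))

∑-snoc : ∀ s (f : ℕ → ℕ) → ∑[ j < suc s ] f (toℕ j) ≡ ∑[ j < s ] f (toℕ j) + f s
∑-snoc zero    f = +-comm (f 0) 0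
∑-snoc (suc s) f = trans (cong (f 0 +_) (∑-snoc s (f ∘ suc))) (sym (+-assoc (f 0) _ _))

∑-gauss : ∀ s → 2 * ∑[ j < s ] toℕ j ≡ s * (s ∸ 1)
∑-gauss zero    = refl
∑-gauss (suc s) = begin
  2 * ∑[ j < suc s ] toℕ j          ≡⟨ cong (2 *_) (∑-snoc s (λ j → j)) ⟩
  2 * (∑[ j < s ] toℕ j + s)        ≡⟨ *-distribˡ-+ 2 (∑[ j < s ] toℕ j) s ⟩
  2 * ∑[ j < s ] toℕ j + 2 * s      ≡⟨ cong (_+ 2 * s) (∑-gauss s) ⟩
  s * (s ∸ 1) + 2 * s               ≡⟨ s*[s∸1]+2*s≡[1+s]*s s ⟩
  suc s * s                          ∎
  where
  open ≡-Reasoning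
  [1+s]*s+2*[1+s]≡[2+s]*[1+s] : ∀ s → suc s * s + 2 * suc s ≡ suc (suc s) * suc s
  [1+s]*s+2*[1+s]≡[2+s]*[1+s] = solve-∀
  s*[s∸1]+2*s≡[1+s]*s : ∀ s → s * (s ∸ 1) + 2 * s ≡ suc s * s
  s*[s∸1]+2*s≡[1+s]*s zero    = refl
  s*[s∸1]+2*s≡[1+s]*s (suc s) = [1+s]*s+2*[1+s]≡[2+s]*[1+s] s

sum-map-allFin : ∀ {k} (f : Fin k → ℕ) → sumᴸ (map f (allFin k)) ≡ ∑[ i < k ] f i
sum-map-allFin f = go f (λ i → i)
  where
  go : ∀ {k m} (f : Fin m → ℕ) (g : Fin k → Fin m) → sumᴸ (map f (List.tabulate g)) ≡ ∑[ i < k ] f (g i)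
  go {zero}  f g = refl
  go {suc k} f g = cong (f (g zero) +_) (go f (g ∘ suc))

sum-map-applyUpTo : ∀ (f g : ℕ → ℕ) k → sumᴸ (map f (applyUpTo g k)) ≡ ∑[ j < k ] f (g (toℕ j))
sum-map-applyUpTo f g zero    = refl
sum-map-applyUpTo f g (suc k) = cong (f (g 0) +_) (sum-map-applyUpTo f (g ∘ suc) k)

<ᵇ-true : ∀ {m n} → m < n → (m <ᵇ n) ≡ true
<ᵇ-true {zero}  (s≤s _)         = refl
<ᵇ-true {suc m} (s≤s (s≤s m<n)) = <ᵇ-true {m} (s≤s m<n)

<ᵇ-false : ∀ {m n} → n ≤ m → (m <ᵇ n) ≡ false
<ᵇ-false z≤n               = refl
<ᵇ-false {suc m} (s≤s n≤m) = <ᵇ-false {m} n≤m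

∑-δ-below : ∀ c → ∑[ u < c ] ⟦ toℕ u ≡ᵇ c ⟧ ≡ 0
∑-δ-below zero    = refl
∑-δ-below (suc c) = ∑-δ-below c

∑-δ-within : ∀ k c → c < k → ∑[ u < k ] ⟦ toℕ u ≡ᵇ c ⟧ ≡ 1
∑-δ-within (suc k) zero    _         = cong suc (sum-replicate-zero k)
∑-δ-within (suc k) (suc c) (s≤s c<k) = ∑-δ-within k c c<k

-- Floors and Turán numbers

module _ (q′ : ℕ) where
  private
    q : ℕ
    q = suc q′

  [x+q]/q≡1+x/q : ∀ x → (x + q) / q ≡ suc (x / q)
  [x+q]/q≡1+x/q x = trans (m/n≡1+[m∸n]/n (m≤n+m q x)) (cong (λ y → suc (y / q)) (m+n∸n≡m x q))

  ∑-floor-window : ∀ x → ∑[ j < q ] ((x + toℕ j) / q) ≡ x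
  ∑-floor-window zero    = ∑-zero {q} (λ j → m<n⇒m/n≡0 (toℕ<n j))
  ∑-floor-window (suc x) = begin
    ∑[ j < q ] ((suc x + toℕ j) / q)                ≡⟨ sum-cong-≗ {q} (λ j → cong (_/ q) (sym (+-suc x (toℕ j)))) ⟩
    ∑[ j < q ] ((x + suc (toℕ j)) / q)              ≡⟨ ∑-snoc q′ (λ j → (x + suc j) / q) ⟩
    rest + (x + q) / q                               ≡⟨ cong (rest +_) ([x+q]/q≡1+x/q x) ⟩
    rest + suc (x / q)                               ≡⟨ +-suc rest (x / q) ⟩
    suc (rest + x / q)                               ≡⟨ cong suc (+-comm rest (x / q)) ⟩
    suc (x / q + rest)                               ≡⟨ cong (λ y → suc (y / q + rest)) (sym (+-identityʳ x)) ⟩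
    suc (∑[ j < q ] ((x + toℕ j) / q))              ≡⟨ cong suc (∑-floor-window x) ⟩
    suc x                                            ∎
    where
    open ≡-Reasoning
    rest : ℕ
    rest = ∑[ j < q′ ] ((x + suc (toℕ j)) / q)

  ∑-floor-past-window : ∀ N a →
    ∑[ j < a + q ] ((N + toℕ j) / q) ≡ N + ∑[ j < a ] ((N + toℕ j) / q + 1)
  ∑-floor-past-window N a = begin
    ∑[ j < a + q ] ((N + toℕ j) / q)                       ≡⟨ ∑-split a q (λ j → (N + j) / q) ⟩
    F + ∑[ j < q ] ((N + (a + toℕ j)) / q)                 ≡⟨ cong (F +_) (sum-cong-≗ {q} (λ j → cong (_/ q) (sym (+-assoc N a (toℕ j))))) ⟩
    F + ∑[ j < q ] ((N + a + toℕ j) / q)                   ≡⟨ cong (F +_) (∑-floor-window (N + a)) ⟩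
    F + (N + a)                                             ≡⟨ rearrange F N a ⟩
    N + (F + a * 1)                                         ≡⟨ cong (λ y → N + (F + y)) (sym (∑-const a 1)) ⟩
    N + (F + ∑[ j < a ] 1)                                  ≡⟨ cong (N +_) (sym (∑-distrib-+ {a} (λ j → (N + toℕ j) / q) (λ _ → 1))) ⟩
    N + ∑[ j < a ] ((N + toℕ j) / q + 1)                   ∎
    where
    open ≡-Reasoning
    F : ℕ
    F = ∑[ j < a ] ((N + toℕ j) / q)
    rearrange : ∀ F N a → F + (N + a) ≡ N + (F + a * 1)
    rearrange = solve-∀

  ∑-floor-≤ : ∀ N s → ∑[ j < s ] ((N + toℕ j) / q) ≤ N + ∑[ j < s ∸ q ] ((N + toℕ j) / q + 1)
  ∑-floor-≤ N s with ≤-total s q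
  ... | inj₁ s≤q = begin
    ∑[ j < s ] f (toℕ j)                                    ≤⟨ m≤m+n _ _ ⟩
    ∑[ j < s ] f (toℕ j) + ∑[ j < q ∸ s ] f (s + toℕ j)    ≡⟨ ∑-split s (q ∸ s) f ⟨
    ∑[ j < s + (q ∸ s) ] f (toℕ j)                          ≡⟨ cong (λ t → ∑[ j < t ] f (toℕ j)) (m+[n∸m]≡n s≤q) ⟩
    ∑[ j < q ] f (toℕ j)                                    ≡⟨ ∑-floor-window N ⟩
    N                                                       ≤⟨ m≤m+n N _ ⟩
    N + ∑[ j < s ∸ q ] (f (toℕ j) + 1)                     ∎
    where
    open ≤-Reasoning
    f : ℕ → ℕ
    f j = (N + j) / q
  ... | inj₂ q≤s = ≤-reflexive (begin
    ∑[ j < s ] ((N + toℕ j) / q)                            ≡⟨ cong (λ t → ∑[ j < t ] ((N + toℕ j) / q)) (sym (m∸n+n≡m q≤s)) ⟩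
    ∑[ j < s ∸ q + q ] ((N + toℕ j) / q)                    ≡⟨ ∑-floor-past-window N (s ∸ q) ⟩
    N + ∑[ j < s ∸ q ] ((N + toℕ j) / q + 1)                ∎)
    where open ≡-Reasoning

  ∑-residue : ∀ c d → c < q → ∑[ u < c + d * q ] ⟦ toℕ u % q ≡ᵇ c ⟧ ≡ d
  ∑-residue c zero c<q = begin
    ∑[ u < c + 0 ] ⟦ toℕ u % q ≡ᵇ c ⟧    ≡⟨ cong (λ t → ∑[ u < t ] ⟦ toℕ u % q ≡ᵇ c ⟧) (+-identityʳ c) ⟩
    ∑[ u < c ] ⟦ toℕ u % q ≡ᵇ c ⟧        ≡⟨ sum-cong-≗ {c} (λ u → cong (λ y → ⟦ y ≡ᵇ c ⟧) (m<n⇒m%n≡m (<-trans (toℕ<n u) c<q))) ⟩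
    ∑[ u < c ] ⟦ toℕ u ≡ᵇ c ⟧            ≡⟨ ∑-δ-below c ⟩
    0                                      ∎
    where open ≡-Reasoning
  ∑-residue c (suc d) c<q = begin
    ∑[ u < c + (q + d * q) ] f (toℕ u)                   ≡⟨ cong (λ t → ∑[ u < t ] f (toℕ u)) (+-comm-middle c q (d * q)) ⟩
    ∑[ u < q + (c + d * q) ] f (toℕ u)                   ≡⟨ ∑-split q (c + d * q) f ⟩
    ∑[ u < q ] f (toℕ u) + ∑[ u < c + d * q ] f (q + toℕ u)
                                                          ≡⟨ cong₂ _+_ first-window (sum-cong-≗ {c + d * q} (λ u → cong (λ y → ⟦ y ≡ᵇ c ⟧) ([m+n]%n≡m%n′ (toℕ u)))) ⟩
    1 + ∑[ u < c + d * q ] f (toℕ u)                     ≡⟨ cong suc (∑-residue c d c<q) ⟩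
    suc d                                                 ∎
    where
    open ≡-Reasoning
    f : ℕ → ℕ
    f u = ⟦ u % q ≡ᵇ c ⟧
    +-comm-middle : ∀ a b c → a + (b + c) ≡ b + (a + c)
    +-comm-middle = solve-∀
    [m+n]%n≡m%n′ : ∀ u → (q + u) % q ≡ u % q
    [m+n]%n≡m%n′ u = trans (cong (_% q) (+-comm q u)) ([m+n]%n≡m%n u q)
    first-window : ∑[ u < q ] f (toℕ u) ≡ 1
    first-window = trans (sum-cong-≗ {q} (λ u → cong (λ y → ⟦ y ≡ᵇ c ⟧) (m<n⇒m%n≡m (toℕ<n u)))) (∑-δ-within q c c<q)

  ∑-same-class : ∀ N → ∑[ u < N ] ⟦ toℕ u % q ≡ᵇ N % q ⟧ ≡ N / q
  ∑-same-class N = trans (cong (λ t → ∑[ u < t ] ⟦ toℕ u % q ≡ᵇ N % q ⟧) (m≡m%n+[m/n]*n N q))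
                         (∑-residue (N % q) (N / q) (m%n<n N q))

  separated : ℕ → ℕ → ℕ
  separated u v = ⟦ (u <ᵇ v) ∧ not (u % q ≡ᵇ v % q) ⟧

  turan-∑ : ∀ N → turan q N ≡ ∑[ u < N ] ∑[ v < N ] separated (toℕ u) (toℕ v)
  turan-∑ N = trans (sum-map-applyUpTo (λ u → sumᴸ (map (separated u) (upTo N))) (λ u → u) N)
                    (sum-cong-≗ {N} (λ u → sum-map-applyUpTo (separated (toℕ u)) (λ v → v) N))

  turan-suc : ∀ N → turan q (suc N) + N / q ≡ turan q N + N
  turan-suc N = begin
    turan q (suc N) + N / q                                  ≡⟨ cong (_+ N / q) (turan-∑ (suc N)) ⟩
    ∑[ u < suc N ] row (suc N) (toℕ u) + N / q              ≡⟨ cong (_+ N / q) (∑-snoc N (row (suc N))) ⟩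
    ∑[ u < N ] row (suc N) (toℕ u) + row (suc N) N + N / q
      ≡⟨ cong₂ (λ x y → x + y + N / q) (sum-cong-≗ {N} (λ u → ∑-snoc N (separated (toℕ u)))) last-row-empty ⟩
    ∑[ u < N ] (row N (toℕ u) + separated (toℕ u) N) + 0 + N / q
      ≡⟨ cong (λ x → x + 0 + N / q) (∑-distrib-+ {N} (λ u → row N (toℕ u)) (λ u → separated (toℕ u) N)) ⟩
    ∑[ u < N ] row N (toℕ u) + C + 0 + N / q                ≡⟨ rearrange _ C (N / q) ⟩
    ∑[ u < N ] row N (toℕ u) + (C + N / q)                  ≡⟨ cong₂ _+_ (sym (turan-∑ N)) last-column ⟩
    turan q N + N                                            ∎
    where
    open ≡-Reasoning
    row : ℕ → ℕ → ℕ
    row N u = ∑[ v < N ] separated u (toℕ v)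
    C : ℕ
    C = ∑[ u < N ] separated (toℕ u) N
    rearrange : ∀ a b c → a + b + 0 + c ≡ a + (b + c)
    rearrange = solve-∀
    last-row-empty : row (suc N) N ≡ 0
    last-row-empty = ∑-zero {suc N}
      (λ v → cong (λ b → ⟦ b ∧ not (N % q ≡ᵇ toℕ v % q) ⟧) (<ᵇ-false (s≤s⁻¹ (toℕ<n v))))
    separated+same : ∀ u → u < N → separated u N + ⟦ u % q ≡ᵇ N % q ⟧ ≡ 1
    separated+same u u<N rewrite <ᵇ-true u<N with u % q ≡ᵇ N % q
    ... | true  = refl
    ... | false = refl
    last-column : C + N / q ≡ N
    last-column = begin
      C + N / q                                                 ≡⟨ cong (C +_) (∑-same-class N) ⟨
      C + ∑[ u < N ] ⟦ toℕ u % q ≡ᵇ N % q ⟧                   ≡⟨ ∑-distrib-+ {N} (λ u → separated (toℕ u) N) (λ u → ⟦ toℕ u % q ≡ᵇ N % q ⟧) ⟨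
      ∑[ u < N ] (separated (toℕ u) N + ⟦ toℕ u % q ≡ᵇ N % q ⟧)
                                                                ≡⟨ sum-cong-≗ {N} (λ u → separated+same (toℕ u) (toℕ<n u)) ⟩
      ∑[ u < N ] 1                                              ≡⟨ trans (∑-const N 1) (*-identityʳ N) ⟩
      N                                                         ∎

  turan-+ : ∀ N s → turan q (N + s) + ∑[ j < s ] ((N + toℕ j) / q) ≡ turan q N + ∑[ j < s ] (N + toℕ j)
  turan-+ N zero    = cong (λ t → turan q t + 0) (+-identityʳ N)
  turan-+ N (suc s) = begin
    turan q (N + suc s) + ∑[ j < suc s ] ((N + toℕ j) / q)
      ≡⟨ cong₂ _+_ (cong (turan q) (+-suc N s)) (∑-snoc s (λ j → (N + j) / q)) ⟩
    turan q (suc (N + s)) + (F + (N + s) / q)          ≡⟨ rearrange (turan q (suc (N + s))) F ((N + s) / q) ⟩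
    (turan q (suc (N + s)) + (N + s) / q) + F          ≡⟨ cong (_+ F) (turan-suc (N + s)) ⟩
    turan q (N + s) + (N + s) + F                      ≡⟨ rearrange′ (turan q (N + s)) (N + s) F ⟩
    turan q (N + s) + F + (N + s)                      ≡⟨ cong (_+ (N + s)) (turan-+ N s) ⟩
    turan q N + ∑[ j < s ] (N + toℕ j) + (N + s)       ≡⟨ +-assoc (turan q N) _ (N + s) ⟩
    turan q N + (∑[ j < s ] (N + toℕ j) + (N + s))     ≡⟨ cong (turan q N +_) (∑-snoc s (N +_)) ⟨
    turan q N + ∑[ j < suc s ] (N + toℕ j)             ∎
    where
    open ≡-Reasoning
    F : ℕ
    F = ∑[ j < s ] ((N + toℕ j) / q)
    rearrange : ∀ a b c → a + (b + c) ≡ a + c + b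
    rearrange = solve-∀
    rearrange′ : ∀ a b c → a + b + c ≡ a + c + b
    rearrange′ = solve-∀

  turan-+-≤ : ∀ N s →
    turan q N + ∑[ j < s ] toℕ j + N * (s ∸ 1) ≤ turan q (N + s) + ∑[ j < s ∸ q ] ((N + toℕ j) / q + 1)
  turan-+-≤ N zero    = ≤-reflexive (begin
    turan q N + 0 + N * 0     ≡⟨ cong (turan q N + 0 +_) (*-zeroʳ N) ⟩
    turan q N + 0 + 0         ≡⟨ +-identityʳ (turan q N + 0) ⟩
    turan q N + 0             ≡⟨ cong (λ t → turan q t + 0) (+-identityʳ N) ⟨
    turan q (N + 0) + 0       ∎)
    where open ≡-Reasoning
  turan-+-≤ N (suc s) = +-cancelʳ-≤ N _ _ (begin
    turan q N + C₂ + N * s + N                    ≡⟨ rearrange (turan q N) C₂ N s ⟩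
    turan q N + (suc s * N + C₂)                  ≡⟨ cong (λ x → turan q N + (x + C₂)) (sym (∑-const (suc s) N)) ⟩
    turan q N + (∑[ j < suc s ] N + C₂)           ≡⟨ cong (turan q N +_) (∑-distrib-+ {suc s} (λ _ → N) toℕ) ⟨
    turan q N + ∑[ j < suc s ] (N + toℕ j)        ≡⟨ turan-+ N (suc s) ⟨
    turan q (N + suc s) + F                       ≤⟨ +-monoʳ-≤ (turan q (N + suc s)) (∑-floor-≤ N (suc s)) ⟩
    turan q (N + suc s) + (N + B)                 ≡⟨ rearrange′ (turan q (N + suc s)) N B ⟩
    turan q (N + suc s) + B + N                   ∎)
    where
    open ≤-Reasoning
    C₂ F B : ℕ
    C₂ = ∑[ j < suc s ] toℕ j
    F = ∑[ j < suc s ] ((N + toℕ j) / q)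
    B = ∑[ j < suc s ∸ q ] ((N + toℕ j) / q + 1)
    rearrange : ∀ t g n s → t + g + n * s + n ≡ t + (suc s * n + g)
    rearrange = solve-∀
    rearrange′ : ∀ t n b → t + (n + b) ≡ t + b + n
    rearrange′ = solve-∀

𝟙 : ∀ {n} → Subset n → Fin n → ℕ
𝟙 p v = ⟦ lookup p v ⟧

∣∣≡∑𝟙 : ∀ {n} (p : Subset n) → ∣ p ∣ ≡ ∑[ v < n ] 𝟙 p v
∣∣≡∑𝟙 []          = refl
∣∣≡∑𝟙 (true ∷ p)  = cong suc (∣∣≡∑𝟙 p)
∣∣≡∑𝟙 (false ∷ p) = ∣∣≡∑𝟙 p

∣∣-+ : ∀ {n} (p q r : Subset n) → (∀ v → 𝟙 p v ≡ 𝟙 q v + 𝟙 r v) → ∣ p ∣ ≡ ∣ q ∣ + ∣ r ∣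
∣∣-+ {n} p q r 𝟙-split = begin
  ∣ p ∣                                  ≡⟨ ∣∣≡∑𝟙 p ⟩
  ∑[ v < n ] 𝟙 p v                      ≡⟨ sum-cong-≗ {n} 𝟙-split ⟩
  ∑[ v < n ] (𝟙 q v + 𝟙 r v)            ≡⟨ ∑-distrib-+ (𝟙 q) (𝟙 r) ⟩
  ∑[ v < n ] 𝟙 q v + ∑[ v < n ] 𝟙 r v  ≡⟨ cong₂ _+_ (∣∣≡∑𝟙 q) (∣∣≡∑𝟙 r) ⟨
  ∣ q ∣ + ∣ r ∣                          ∎
  where open ≡-Reasoning

module _ {n : ℕ} {p : Subset n} {v : Fin n} where

  ∉⇒lookup≡false : v ∉ p → lookup p v ≡ false
  ∉⇒lookup≡false v∉p with lookup p v in eq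
  ... | true  = contradiction (lookup⇒[]= v p eq) v∉p
  ... | false = refl

  𝟙-∈ : v ∈ p → 𝟙 p v ≡ 1
  𝟙-∈ v∈p = cong ⟦_⟧ ([]=⇒lookup v∈p)

  𝟙-∉ : v ∉ p → 𝟙 p v ≡ 0
  𝟙-∉ v∉p = cong ⟦_⟧ (∉⇒lookup≡false v∉p)

𝟙-∩ : ∀ {n} (p q : Subset n) v → 𝟙 (p ∩ q) v ≡ 𝟙 p v * 𝟙 q v
𝟙-∩ p q v rewrite lookup-zipWith _∧_ v p q with lookup p v
... | true  = sym (+-identityʳ _)
... | false = refl

lookup-─ : ∀ {n} (p q : Subset n) v → lookup (p ─ q) v ≡ lookup p v ∧ not (lookup q v)
lookup-─ (x ∷ p) (true ∷ q)  zero    = sym (∧-zeroʳ x)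
lookup-─ (x ∷ p) (false ∷ q) zero    = sym (∧-identityʳ x)
lookup-─ (x ∷ p) (y ∷ q)     (suc v) = lookup-─ p q v

𝟙-─ : ∀ {n} (p q : Subset n) → q ⊆ p → ∀ v → 𝟙 p v ≡ 𝟙 q v + 𝟙 (p ─ q) v
𝟙-─ p q q⊆p v rewrite lookup-─ p q v with lookup q v in eq
... | true  = trans (𝟙-∈ (q⊆p (lookup⇒[]= v q eq))) (cong suc (cong ⟦_⟧ (sym (∧-zeroʳ (lookup p v)))))
... | false = cong ⟦_⟧ (sym (∧-identityʳ (lookup p v)))

∣p∣≡∣q∣+∣p─q∣ : ∀ {n} {p q : Subset n} → q ⊆ p → ∣ p ∣ ≡ ∣ q ∣ + ∣ p ─ q ∣
∣p∣≡∣q∣+∣p─q∣ {p = p} {q} q⊆p = ∣∣-+ p q (p ─ q) (𝟙-─ p q q⊆p)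

x∈p─q⇒x∉q : ∀ {n} {p q : Subset n} {x} → x ∈ p ─ q → x ∉ q
x∈p─q⇒x∉q {p = p} {q} {x} x∈p─q x∈q with () ←
  trans (sym ([]=⇒lookup x∈p─q))
        (trans (lookup-─ p q x) (trans (cong (λ b → lookup p x ∧ not b) ([]=⇒lookup x∈q)) (∧-zeroʳ (lookup p x))))

⊆-of-size : ∀ {n} (p : Subset n) {s} → s ≤ ∣ p ∣ → ∃ λ t → t ⊆ p × ∣ t ∣ ≡ s
⊆-of-size {n} p       {zero}  _ = ⊥ , ⊥⊆ , ∣⊥∣≡0 n
⊆-of-size (true ∷ p)  {suc s} (s≤s s≤∣p∣) with ⊆-of-size p s≤∣p∣
... | t , t⊆p , ∣t∣≡s = inside ∷ t , s⊆s t⊆p , cong suc ∣t∣≡s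
⊆-of-size (false ∷ p) {suc s} s<∣p∣ with ⊆-of-size p s<∣p∣
... | t , t⊆p , ∣t∣≡s = outside ∷ t , s⊆s t⊆p , ∣t∣≡s

0<∣p∣⇒Nonempty : ∀ {n} {p : Subset n} → 0 < ∣ p ∣ → Nonempty p
0<∣p∣⇒Nonempty {n} {p} 0<∣p∣ with nonempty? p
... | yes p≢∅ = p≢∅
... | no  p≡∅ = contradiction (trans (cong ∣_∣ (Empty-unique p≡∅)) (∣⊥∣≡0 n)) (>⇒≢ 0<∣p∣)

Largest : ∀ {n} → (Subset n → Set) → Subset n → Set
Largest P p = P p × (∀ p′ → P p′ → ∣ p′ ∣ ≤ ∣ p ∣)

∄⊎largest : ∀ {n} {P : Subset n → Set} → (∀ p → Dec (P p)) → (∀ p → ¬ P p) ⊎ ∃ (Largest P)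
∄⊎largest {zero} P? with P? []
... | yes P[] = inj₂ ([] , P[] , λ { [] _ → z≤n })
... | no ¬P[] = inj₁ λ { [] → ¬P[] }
∄⊎largest {suc n} P? with ∄⊎largest (P? ∘ (outside ∷_)) | ∄⊎largest (P? ∘ (inside ∷_))
... | inj₁ ∄₀ | inj₁ ∄₁ = inj₁ λ { (false ∷ p) → ∄₀ p ; (true ∷ p) → ∄₁ p }
... | inj₂ (p₀ , P₀ , max₀) | inj₁ ∄₁ =
  inj₂ (outside ∷ p₀ , P₀ , λ { (false ∷ p) Pp → max₀ p Pp ; (true ∷ p) Pp → contradiction Pp (∄₁ p) })
... | inj₁ ∄₀ | inj₂ (p₁ , P₁ , max₁) =
  inj₂ (inside ∷ p₁ , P₁ , λ { (false ∷ p) Pp → contradiction Pp (∄₀ p) ; (true ∷ p) Pp → s≤s (max₁ p Pp) })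
... | inj₂ (p₀ , P₀ , max₀) | inj₂ (p₁ , P₁ , max₁) with ∣ p₀ ∣ ≤? suc ∣ p₁ ∣
...   | yes ∣p₀∣≤ = inj₂ (inside ∷ p₁ , P₁ ,
          λ { (false ∷ p) Pp → ≤-trans (max₀ p Pp) ∣p₀∣≤ ; (true ∷ p) Pp → s≤s (max₁ p Pp) })
...   | no  ∣p₀∣≰ = inj₂ (outside ∷ p₀ , P₀ ,
          λ { (false ∷ p) Pp → max₀ p Pp ; (true ∷ p) Pp → ≤-trans (s≤s (max₁ p Pp)) (<⇒≤ (≰⇒> ∣p₀∣≰)) })

largest : ∀ {n} {P : Subset n → Set} → (∀ p → Dec (P p)) → ∀ {p} → P p → ∃ (Largest P)
largest P? {p} Pp with ∄⊎largest P?
... | inj₁ ∄ = contradiction Pp (∄ p)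
... | inj₂ max = max

∣⁅x⁆∪p∣ : ∀ {n} {x : Fin n} {p : Subset n} → x ∉ p → ∣ ⁅ x ⁆ ∪ p ∣ ≡ suc ∣ p ∣
∣⁅x⁆∪p∣ {n} {x} {p} x∉p = trans (∣∣-+ (⁅ x ⁆ ∪ p) ⁅ x ⁆ p split) (cong (_+ ∣ p ∣) (∣⁅x⁆∣≡1 x))
  where
  split : ∀ v → 𝟙 (⁅ x ⁆ ∪ p) v ≡ 𝟙 ⁅ x ⁆ v + 𝟙 p v
  split v rewrite lookup-zipWith _∨_ v ⁅ x ⁆ p with v ≟ x
  ... | yes refl rewrite []=⇒lookup (x∈⁅x⁆ x) | ∉⇒lookup≡false x∉p = refl
  ... | no  v≢x  rewrite ∉⇒lookup≡false (x≢y⇒x∉⁅y⁆ v≢x) = refl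

-- Cliques and arcs

module _ {n : ℕ} (G : Graph n) where

  nbhd : Fin n → Subset n
  nbhd u = tabulate (adj G u)

  𝟙-nbhd : ∀ u v → 𝟙 (nbhd u) v ≡ ⟦ adj G u v ⟧
  𝟙-nbhd u v = cong ⟦_⟧ (lookup∘tabulate (adj G u) v)

  ∈nbhd⇒adj : ∀ {u v} → v ∈ nbhd u → adj G u v ≡ true
  ∈nbhd⇒adj {u} {v} v∈ = trans (sym (lookup∘tabulate (adj G u) v)) ([]=⇒lookup v∈)

  ∉nbhd : ∀ u → u ∉ nbhd u
  ∉nbhd u u∈ with () ← trans (sym (∈nbhd⇒adj u∈)) (adj-irrefl G u)

  clique-⊆ : ∀ {S T} → T ⊆ S → IsClique G S → IsClique G T
  clique-⊆ T⊆S clS u v u∈T v∈T = clS u v (T⊆S u∈T) (T⊆S v∈T)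

  IsMaxCliqueIn-resp : ∀ {R R′ : Fin n → Set} {Q} → (∀ {v} → R v → R′ v) → (∀ {v} → R′ v → R v) →
                       IsMaxCliqueIn G R Q → IsMaxCliqueIn G R′ Q
  IsMaxCliqueIn-resp R⇒R′ R′⇒R (clQ , Q⊆R , maxQ) =
    clQ , (λ v v∈Q → R⇒R′ (Q⊆R v v∈Q)) , λ T clT T⊆R′ → maxQ T clT (λ v v∈T → R′⇒R (T⊆R′ v v∈T))

  HasKrIn-mono : ∀ {r} {R R′ : Fin n → Set} → (∀ {v} → R v → R′ v) → HasKrIn G r R → HasKrIn G r R′
  HasKrIn-mono R⇒R′ (T , clT , T⊆R , ∣T∣) = T , clT , (λ v v∈T → R⇒R′ (T⊆R v v∈T)) , ∣T∣

  ⁅⁆-clique : ∀ {v} → IsClique G ⁅ v ⁆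
  ⁅⁆-clique {v} x y x∈ y∈ x≢y = contradiction (trans (x∈⁅y⁆⇒x≡y v x∈) (sym (x∈⁅y⁆⇒x≡y v y∈))) x≢y

  clique-extend : ∀ {u B} → IsClique G B → B ⊆ nbhd u →
                  IsClique G (⁅ u ⁆ ∪ B) × ∣ ⁅ u ⁆ ∪ B ∣ ≡ suc ∣ B ∣
  clique-extend {u} {B} clB B⊆nbhd = clique , ∣⁅x⁆∪p∣ (∉nbhd u ∘ B⊆nbhd)
    where
    clique : IsClique G (⁅ u ⁆ ∪ B)
    clique x y x∈ y∈ x≢y with x∈p∪q⁻ ⁅ u ⁆ B x∈ | x∈p∪q⁻ ⁅ u ⁆ B y∈
    ... | inj₁ x∈⁅u⁆ | inj₁ y∈⁅u⁆ = ⁅⁆-clique x y x∈⁅u⁆ y∈⁅u⁆ x≢y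
    ... | inj₁ x∈⁅u⁆ | inj₂ y∈B    rewrite x∈⁅y⁆⇒x≡y u x∈⁅u⁆ = ∈nbhd⇒adj (B⊆nbhd y∈B)
    ... | inj₂ x∈B    | inj₁ y∈⁅u⁆ rewrite x∈⁅y⁆⇒x≡y u y∈⁅u⁆ = trans (adj-sym G x u) (∈nbhd⇒adj (B⊆nbhd x∈B))
    ... | inj₂ x∈B    | inj₂ y∈B    = clB x y x∈B y∈B x≢y

  clique-∣∣ : ∀ {Q u} → IsClique G Q → u ∈ Q → ∣ Q ∣ ≡ suc ∣ Q ∩ nbhd u ∣
  clique-∣∣ {Q} {u} clQ u∈Q = trans (∣∣-+ Q ⁅ u ⁆ (Q ∩ nbhd u) split) (cong (_+ ∣ Q ∩ nbhd u ∣) (∣⁅x⁆∣≡1 u))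
    where
    split : ∀ v → 𝟙 Q v ≡ 𝟙 ⁅ u ⁆ v + 𝟙 (Q ∩ nbhd u) v
    split v rewrite 𝟙-∩ Q (nbhd u) v | 𝟙-nbhd u v with v ≟ u
    ... | yes refl rewrite 𝟙-∈ u∈Q | 𝟙-∈ (x∈⁅x⁆ u) | adj-irrefl G u = refl
    ... | no  v≢u  rewrite 𝟙-∉ (x≢y⇒x∉⁅y⁆ v≢u) with v ∈? Q
    ...   | yes v∈Q rewrite 𝟙-∈ v∈Q | clQ u v u∈Q v∈Q (v≢u ∘ sym) = refl
    ...   | no  v∉Q rewrite 𝟙-∉ v∉Q = refl

  maxClique-∣∣ : ∀ {R Q u} → IsMaxCliqueIn G R Q → R u → suc ∣ Q ∩ nbhd u ∣ ≤ ∣ Q ∣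
  maxClique-∣∣ {R} {Q} {u} (clQ , Q⊆R , maxQ) Ru with clique-extend {u} (clique-⊆ (p∩q⊆p Q (nbhd u)) clQ) (p∩q⊆q Q (nbhd u))
  ... | clT , ∣T∣ = subst (_≤ ∣ Q ∣) ∣T∣ (maxQ _ clT T⊆R)
    where
    T⊆R : InsideP R (⁅ u ⁆ ∪ (Q ∩ nbhd u))
    T⊆R v v∈T with x∈p∪q⁻ ⁅ u ⁆ (Q ∩ nbhd u) v∈T
    ... | inj₁ v∈⁅u⁆ rewrite x∈⁅y⁆⇒x≡y u v∈⁅u⁆ = Ru
    ... | inj₂ v∈B = Q⊆R v (p∩q⊆p Q (nbhd u) v∈B)

  module _ {q : ℕ} {M : Subset n} (noKr : ¬ KrMeets G (suc q) M) where

    ∣∩nbhd∣<q : ∀ {Q u} → IsClique G Q → u ∈ M → ∣ Q ∩ nbhd u ∣ < q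
    ∣∩nbhd∣<q {Q} {u} clQ u∈M with q ≤? ∣ Q ∩ nbhd u ∣
    ... | no  q≰ = ≰⇒> q≰
    ... | yes q≤ with ⊆-of-size (Q ∩ nbhd u) q≤
    ...   | B , B⊆ , ∣B∣≡q with clique-extend {u} (clique-⊆ (⊆-trans B⊆ (p∩q⊆p Q (nbhd u))) clQ) (⊆-trans B⊆ (p∩q⊆q Q (nbhd u)))
    ...     | clT , ∣T∣ = contradiction (_ , clT , trans ∣T∣ (cong suc ∣B∣≡q) , u , x∈p∪q⁺ (inj₁ (x∈⁅x⁆ u)) , u∈M) noKr

    ∉-large-clique : ∀ {Q u} → IsClique G Q → suc q ≤ ∣ Q ∣ → u ∈ M → u ∉ Q
    ∉-large-clique clQ q<∣Q∣ u∈M u∈Q =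
      <⇒≱ (∣∩nbhd∣<q clQ u∈M) (s≤s⁻¹ (subst (suc _ ≤_) (clique-∣∣ clQ u∈Q) q<∣Q∣))

  degIn : (Fin n → ℕ) → Fin n → ℕ
  degIn g u = ∑[ v < n ] (g v * ⟦ adj G u v ⟧)

  -- arcs (𝟙 W) (𝟙 W) counts every edge of G[W] twice, once per orientation.
  arcs : (Fin n → ℕ) → (Fin n → ℕ) → ℕ
  arcs f g = ∑[ u < n ] (f u * degIn g u)

  degIn-𝟙 : ∀ Q u → degIn (𝟙 Q) u ≡ ∣ Q ∩ nbhd u ∣
  degIn-𝟙 Q u = sym (trans (∣∣≡∑𝟙 (Q ∩ nbhd u))
    (sum-cong-≗ {n} (λ v → trans (𝟙-∩ Q (nbhd u) v) (cong (𝟙 Q v *_) (𝟙-nbhd u v)))))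

  arcs-cong : ∀ {f f′ g g′} → (∀ u → f u ≡ f′ u) → (∀ v → g v ≡ g′ v) → arcs f g ≡ arcs f′ g′
  arcs-cong f≗f′ g≗g′ = sum-cong-≗ {n} (λ u →
    cong₂ _*_ (f≗f′ u) (sum-cong-≗ {n} (λ v → cong (_* ⟦ adj G u v ⟧) (g≗g′ v))))

  arcs-+ˡ : ∀ f f′ g → arcs (λ u → f u + f′ u) g ≡ arcs f g + arcs f′ g
  arcs-+ˡ f f′ g = trans (sum-cong-≗ {n} (λ u → *-distribʳ-+ (degIn g u) (f u) (f′ u)))
                         (∑-distrib-+ (λ u → f u * degIn g u) (λ u → f′ u * degIn g u))

  arcs-comm : ∀ f g → arcs f g ≡ arcs g f
  arcs-comm f g = begin
    ∑[ u < n ] (f u * ∑[ v < n ] (g v * ⟦ adj G u v ⟧))    ≡⟨ sum-cong-≗ {n} (λ u → *-distribˡ-sum (f u) (λ v → g v * ⟦ adj G u v ⟧)) ⟩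
    ∑[ u < n ] ∑[ v < n ] (f u * (g v * ⟦ adj G u v ⟧))    ≡⟨ ∑-comm (λ u v → f u * (g v * ⟦ adj G u v ⟧)) ⟩
    ∑[ v < n ] ∑[ u < n ] (f u * (g v * ⟦ adj G u v ⟧))    ≡⟨ sum-cong-≗ {n} (λ v → sum-cong-≗ {n} (λ u → swap (f u) (g v) (adj-sym G u v))) ⟩
    ∑[ v < n ] ∑[ u < n ] (g v * (f u * ⟦ adj G v u ⟧))    ≡⟨ sum-cong-≗ {n} (λ v → *-distribˡ-sum (g v) (λ u → f u * ⟦ adj G v u ⟧)) ⟨
    ∑[ v < n ] (g v * ∑[ u < n ] (f u * ⟦ adj G v u ⟧))    ∎
    where
    open ≡-Reasoning
    swap : ∀ x y {a b} → a ≡ b → x * (y * ⟦ a ⟧) ≡ y * (x * ⟦ b ⟧)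
    swap x y {a} refl = x*[y*z]≡y*[x*z] x y ⟦ a ⟧
      where
      x*[y*z]≡y*[x*z] : ∀ x y z → x * (y * z) ≡ y * (x * z)
      x*[y*z]≡y*[x*z] = solve-∀

  arcs-+ʳ : ∀ f g g′ → arcs f (λ v → g v + g′ v) ≡ arcs f g + arcs f g′
  arcs-+ʳ f g g′ = begin
    arcs f (λ v → g v + g′ v)      ≡⟨ arcs-comm f (λ v → g v + g′ v) ⟩
    arcs (λ v → g v + g′ v) f      ≡⟨ arcs-+ˡ g g′ f ⟩
    arcs g f + arcs g′ f           ≡⟨ cong₂ _+_ (arcs-comm g f) (arcs-comm g′ f) ⟩
    arcs f g + arcs f g′           ∎
    where open ≡-Reasoning

  arcs-⊤ : arcs (𝟙 ⊤) (𝟙 ⊤) ≡ 2 * e G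
  arcs-⊤ = begin
    arcs (𝟙 ⊤) (𝟙 ⊤)                                ≡⟨ sum-cong-≗ {n} row ⟩
    ∑[ u < n ] ∑[ v < n ] A u v                       ≡⟨ sum-cong-≗ {n} (λ u → sum-cong-≗ {n} (A≡L+Lᵀ u)) ⟩
    ∑[ u < n ] ∑[ v < n ] (L u v + L v u)             ≡⟨ sum-cong-≗ {n} (λ u → ∑-distrib-+ (L u) (λ v → L v u)) ⟩
    ∑[ u < n ] (∑[ v < n ] L u v + ∑[ v < n ] L v u)  ≡⟨ ∑-distrib-+ (λ u → ∑[ v < n ] L u v) (λ u → ∑[ v < n ] L v u) ⟩
    e′ + ∑[ u < n ] ∑[ v < n ] L v u                  ≡⟨ cong (e′ +_) (∑-comm (λ u v → L v u)) ⟩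
    e′ + e′                                            ≡⟨ cong (λ x → x + x) e≡e′ ⟨
    e G + e G                                          ≡⟨ cong (e G +_) (+-identityʳ (e G)) ⟨
    2 * e G                                            ∎
    where
    open ≡-Reasoning
    A L : Fin n → Fin n → ℕ
    A u v = ⟦ adj G u v ⟧
    L u v = ⟦ (toℕ u <ᵇ toℕ v) ∧ adj G u v ⟧
    e′ : ℕ
    e′ = ∑[ u < n ] ∑[ v < n ] L u v
    𝟙⊤ : ∀ v → 𝟙 ⊤ v ≡ 1
    𝟙⊤ v = 𝟙-∈ (∈⊤ {x = v})
    row : ∀ u → 𝟙 ⊤ u * degIn (𝟙 ⊤) u ≡ ∑[ v < n ] A u v
    row u = trans (cong (_* degIn (𝟙 ⊤) u) (𝟙⊤ u)) (trans (*-identityˡ (degIn (𝟙 ⊤) u))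
                  (sum-cong-≗ {n} (λ v → trans (cong (_* A u v) (𝟙⊤ v)) (*-identityˡ (A u v)))))
    e≡e′ : e G ≡ e′
    e≡e′ = trans (sum-map-allFin (λ u → sumᴸ (map (L u) (allFin n)))) (sum-cong-≗ {n} (λ u → sum-map-allFin (L u)))
    A≡L+Lᵀ : ∀ u v → A u v ≡ L u v + L v u
    A≡L+Lᵀ u v with <-cmp (toℕ u) (toℕ v)
    ... | tri< u<v _ _ rewrite <ᵇ-true u<v | <ᵇ-false (<⇒≤ u<v) = sym (+-identityʳ _)
    ... | tri> _ _ v<u rewrite <ᵇ-true v<u | <ᵇ-false (<⇒≤ v<u) = cong ⟦_⟧ (adj-sym G u v)
    ... | tri≈ _ u≡v _ rewrite toℕ-injective u≡v | adj-irrefl G v | <ᵇ-false (≤-refl {toℕ v}) = refl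

  arcs-clique : ∀ {Q} → IsClique G Q → arcs (𝟙 Q) (𝟙 Q) ≡ ∣ Q ∣ * (∣ Q ∣ ∸ 1)
  arcs-clique {Q} clQ = begin
    ∑[ u < n ] (𝟙 Q u * degIn (𝟙 Q) u)     ≡⟨ sum-cong-≗ {n} inner-degree ⟩
    ∑[ u < n ] (𝟙 Q u * (∣ Q ∣ ∸ 1))       ≡⟨ *-distribʳ-sum (∣ Q ∣ ∸ 1) (𝟙 Q) ⟨
    (∑[ u < n ] 𝟙 Q u) * (∣ Q ∣ ∸ 1)       ≡⟨ cong (_* (∣ Q ∣ ∸ 1)) (∣∣≡∑𝟙 Q) ⟨
    ∣ Q ∣ * (∣ Q ∣ ∸ 1)                     ∎
    where
    open ≡-Reasoning
    inner-degree : ∀ u → 𝟙 Q u * degIn (𝟙 Q) u ≡ 𝟙 Q u * (∣ Q ∣ ∸ 1)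
    inner-degree u with u ∈? Q
    ... | yes u∈Q rewrite 𝟙-∈ u∈Q | degIn-𝟙 Q u | clique-∣∣ clQ u∈Q = refl
    ... | no  u∉Q rewrite 𝟙-∉ u∉Q = refl

  arcs-split : ∀ {W Q} → Q ⊆ W → IsClique G Q →
    arcs (𝟙 W) (𝟙 W) ≡ arcs (𝟙 (W ─ Q)) (𝟙 (W ─ Q)) + ∣ Q ∣ * (∣ Q ∣ ∸ 1) + 2 * arcs (𝟙 (W ─ Q)) (𝟙 Q)
  arcs-split {W} {Q} Q⊆W clQ = begin
    arcs (𝟙 W) (𝟙 W)                                    ≡⟨ arcs-cong split split ⟩
    arcs a+b a+b                                        ≡⟨ arcs-+ˡ a b a+b ⟩
    arcs a a+b + arcs b a+b                             ≡⟨ cong₂ _+_ (arcs-+ʳ a a b) (arcs-+ʳ b a b) ⟩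
    (arcs a a + arcs a b) + (arcs b a + arcs b b)       ≡⟨ cong₂ (λ x y → (x + y) + (arcs b a + arcs b b)) (arcs-clique clQ) (arcs-comm a b) ⟩
    (s + arcs b a) + (arcs b a + arcs b b)              ≡⟨ rearrange s (arcs b a) (arcs b b) ⟩
    arcs b b + s + 2 * arcs b a                         ∎
    where
    open ≡-Reasoning
    a b a+b : Fin n → ℕ
    a = 𝟙 Q
    b = 𝟙 (W ─ Q)
    a+b v = a v + b v
    s : ℕ
    s = ∣ Q ∣ * (∣ Q ∣ ∸ 1)
    split = 𝟙-─ W Q Q⊆W
    rearrange : ∀ x y z → (x + y) + (y + z) ≡ z + x + 2 * y
    rearrange = solve-∀

  arcs-to-maxClique : ∀ {q R Q X M} → IsMaxCliqueIn G R Q → InsideP R X → M ⊆ X → ¬ KrMeets G (suc q) M →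
    arcs (𝟙 X) (𝟙 Q) + (∣ Q ∣ ∸ q) * ∣ M ∣ ≤ ∣ X ∣ * (∣ Q ∣ ∸ 1)
  arcs-to-maxClique {q} {R} {Q} {X} {M} maxQ@(clQ , _ , _) X⊆R M⊆X noKr = begin
    arcs (𝟙 X) (𝟙 Q) + c * ∣ M ∣                           ≡⟨ cong (arcs (𝟙 X) (𝟙 Q) +_) (trans (cong (c *_) (∣∣≡∑𝟙 M)) (*-distribˡ-sum c (𝟙 M))) ⟩
    arcs (𝟙 X) (𝟙 Q) + ∑[ u < n ] (c * 𝟙 M u)              ≡⟨ ∑-distrib-+ (λ u → 𝟙 X u * degIn (𝟙 Q) u) (λ u → c * 𝟙 M u) ⟨
    ∑[ u < n ] (𝟙 X u * degIn (𝟙 Q) u + c * 𝟙 M u)         ≤⟨ ∑-mono-≤ pointwise ⟩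
    ∑[ u < n ] (𝟙 X u * (∣ Q ∣ ∸ 1))                        ≡⟨ *-distribʳ-sum (∣ Q ∣ ∸ 1) (𝟙 X) ⟨
    (∑[ u < n ] 𝟙 X u) * (∣ Q ∣ ∸ 1)                        ≡⟨ cong (_* (∣ Q ∣ ∸ 1)) (∣∣≡∑𝟙 X) ⟨
    ∣ X ∣ * (∣ Q ∣ ∸ 1)                                      ∎
    where
    open ≤-Reasoning
    c : ℕ
    c = ∣ Q ∣ ∸ q
    d<s : ∀ {u} → u ∈ X → suc ∣ Q ∩ nbhd u ∣ ≤ ∣ Q ∣
    d<s u∈X = maxClique-∣∣ maxQ (X⊆R _ u∈X)
    d+[s∸q]≤s∸1 : ∀ {d s} → d < q → d < s → d + (s ∸ q) ≤ s ∸ 1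
    d+[s∸q]≤s∸1 {d} {s} d<q d<s = ≤-trans (+-monoʳ-≤ d (∸-monoʳ-≤ s d<q))
      (≤-reflexive (trans (cong pred (m+[n∸m]≡n d<s)) (pred[m∸n]≡m∸[1+n] s 0)))
    pointwise : ∀ u → 𝟙 X u * degIn (𝟙 Q) u + c * 𝟙 M u ≤ 𝟙 X u * (∣ Q ∣ ∸ 1)
    pointwise u rewrite degIn-𝟙 Q u with u ∈? M
    ... | yes u∈M rewrite 𝟙-∈ u∈M | 𝟙-∈ (M⊆X u∈M) | +-identityʳ ∣ Q ∩ nbhd u ∣ | *-identityʳ c | +-identityʳ (∣ Q ∣ ∸ 1) =
      d+[s∸q]≤s∸1 (∣∩nbhd∣<q noKr clQ u∈M) (d<s (M⊆X u∈M))
    ... | no  u∉M rewrite 𝟙-∉ u∉M | *-zeroʳ c | +-identityʳ (𝟙 X u * ∣ Q ∩ nbhd u ∣) with u ∈? X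
    ...   | yes u∈X rewrite 𝟙-∈ u∈X | +-identityʳ ∣ Q ∩ nbhd u ∣ | +-identityʳ (∣ Q ∣ ∸ 1) =
      ∸-monoˡ-≤ 1 (d<s u∈X)
    ...   | no  u∉X rewrite 𝟙-∉ u∉X = z≤n

  -- Rearranged to avoid subtraction: the slack 2 t_q(|W|) − arcs (𝟙 W) (𝟙 W) exceeds that
  -- of W ─ Q by at least 2 (|Q| − q) |M| minus twice the block of floors on the right.
  arcs-peel : ∀ q′ {W Q M} → IsMaxCliqueIn G (_∈ W) Q → M ⊆ W ─ Q → ¬ KrMeets G (suc (suc q′)) M →
    arcs (𝟙 W) (𝟙 W) + 2 * ((∣ Q ∣ ∸ suc q′) * ∣ M ∣) + 2 * turan (suc q′) ∣ W ─ Q ∣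
      ≤ arcs (𝟙 (W ─ Q)) (𝟙 (W ─ Q)) + 2 * turan (suc q′) ∣ W ∣
        + 2 * ∑[ j < ∣ Q ∣ ∸ suc q′ ] ((∣ W ─ Q ∣ + toℕ j) / suc q′ + 1)
  arcs-peel q′ {W} {Q} {M} maxQ@(clQ , Q⊆W , _) M⊆W─Q noKr = begin
    A + 2 * (c * m) + 2 * t′                             ≡⟨ cong (λ a → a + 2 * (c * m) + 2 * t′) (arcs-split (λ {x} → Q⊆W x) clQ) ⟩
    A′ + s * (s ∸ 1) + 2 * X + 2 * (c * m) + 2 * t′      ≡⟨ cong (λ g → A′ + g + 2 * X + 2 * (c * m) + 2 * t′) (sym (∑-gauss s)) ⟩
    A′ + 2 * C₂ + 2 * X + 2 * (c * m) + 2 * t′            ≡⟨ rearrange A′ C₂ X (c * m) t′ ⟩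
    A′ + 2 * (X + c * m) + 2 * (t′ + C₂)                  ≤⟨ +-monoˡ-≤ (2 * (t′ + C₂)) (+-monoʳ-≤ A′ (*-monoʳ-≤ 2 cross)) ⟩
    A′ + 2 * (N′ * (s ∸ 1)) + 2 * (t′ + C₂)               ≡⟨ rearrange′ A′ (N′ * (s ∸ 1)) t′ C₂ ⟩
    A′ + 2 * (t′ + C₂ + N′ * (s ∸ 1))                     ≤⟨ +-monoʳ-≤ A′ (*-monoʳ-≤ 2 (turan-+-≤ q′ N′ s)) ⟩
    A′ + 2 * (turan q (N′ + s) + B)                      ≡⟨ cong (λ N → A′ + 2 * (turan q N + B)) (trans (+-comm N′ s) (sym ∣W∣≡s+N′)) ⟩
    A′ + 2 * (turan q ∣ W ∣ + B)                         ≡⟨ rearrange″ A′ (turan q ∣ W ∣) B ⟩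
    A′ + 2 * turan q ∣ W ∣ + 2 * B                       ∎
    where
    open ≤-Reasoning
    q s c m N′ A A′ X C₂ t′ B : ℕ
    q = suc q′
    s = ∣ Q ∣
    c = s ∸ q
    m = ∣ M ∣
    N′ = ∣ W ─ Q ∣
    A = arcs (𝟙 W) (𝟙 W)
    A′ = arcs (𝟙 (W ─ Q)) (𝟙 (W ─ Q))
    X = arcs (𝟙 (W ─ Q)) (𝟙 Q)
    C₂ = ∑[ j < s ] toℕ j
    t′ = turan q N′
    B = ∑[ j < c ] ((N′ + toℕ j) / q + 1)
    ∣W∣≡s+N′ : ∣ W ∣ ≡ s + N′
    ∣W∣≡s+N′ = ∣p∣≡∣q∣+∣p─q∣ (λ {x} → Q⊆W x)
    cross : X + c * m ≤ N′ * (s ∸ 1)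
    cross = arcs-to-maxClique maxQ (λ v v∈W─Q → p─q⊆p W Q v∈W─Q) M⊆W─Q noKr
    rearrange : ∀ a g x y t → a + 2 * g + 2 * x + 2 * y + 2 * t ≡ a + 2 * (x + y) + 2 * (t + g)
    rearrange = solve-∀
    rearrange′ : ∀ a z t g → a + 2 * z + 2 * (t + g) ≡ a + 2 * (t + g + z)
    rearrange′ = solve-∀
    rearrange″ : ∀ a t b → a + 2 * (t + b) ≡ a + 2 * t + 2 * b
    rearrange″ = solve-∀

  arcs-Empty : ∀ {W} g → Empty W → arcs (𝟙 W) g ≡ 0
  arcs-Empty {W} g W≡∅ = ∑-zero {n} (λ u → cong (_* degIn g u) (𝟙-∉ (λ u∈W → W≡∅ (u , u∈W))))

  clique-in? : ∀ W T → Dec (IsClique G T × InsideP (_∈ W) T)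
  clique-in? W T =
    all? (λ u → all? (λ v → (u ∈? T) →-dec (v ∈? T) →-dec ¬? (u ≟ v) →-dec (adj G u v ≟ᵇ true)))
    ×-dec all? (λ v → (v ∈? T) →-dec (v ∈? W))

  maxClique : ∀ W → ∃ (IsMaxCliqueIn G (_∈ W))
  maxClique W with largest (clique-in? W) {⊥} ((λ u _ u∈⊥ → contradiction u∈⊥ ∉⊥) , (λ _ v∈⊥ → contradiction v∈⊥ ∉⊥))
  ... | Q , (clQ , Q⊆W) , maxQ = Q , clQ , Q⊆W , λ T clT T⊆W → maxQ T (clT , T⊆W)

  clique-∣∣≤ : ∀ {q R Q} → ¬ HasKrIn G (suc q) R → IsClique G Q → InsideP R Q → ∣ Q ∣ ≤ q
  clique-∣∣≤ {q} {R} {Q} noKr clQ Q⊆R with q <? ∣ Q ∣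
  ... | no  q≮∣Q∣ = ≮⇒≥ q≮∣Q∣
  ... | yes q<∣Q∣ with ⊆-of-size Q q<∣Q∣
  ...   | T , T⊆Q , ∣T∣ = contradiction (T , clique-⊆ T⊆Q clQ , (λ x x∈T → Q⊆R x (T⊆Q x∈T)) , ∣T∣) noKr

  maxClique-meets : ∀ {W Q v} → IsMaxCliqueIn G (_∈ W) Q → v ∈ W → Nonempty (W ∩ Q)
  maxClique-meets {W} {Q} {v} (_ , Q⊆W , largestQ) v∈W = x , x∈p∩q⁺ (Q⊆W x x∈Q , x∈Q)
    where
    ⁅v⁆⊆W : InsideP (_∈ W) ⁅ v ⁆
    ⁅v⁆⊆W x x∈⁅v⁆ = subst (_∈ W) (sym (x∈⁅y⁆⇒x≡y v x∈⁅v⁆)) v∈W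
    Q≢∅ : Nonempty Q
    Q≢∅ = 0<∣p∣⇒Nonempty (subst (_≤ ∣ Q ∣) (∣⁅x⁆∣≡1 v) (largestQ ⁅ v ⁆ ⁅⁆-clique ⁅v⁆⊆W))
    x : Fin n
    x = proj₁ Q≢∅
    x∈Q : x ∈ Q
    x∈Q = proj₂ Q≢∅

  turan-theorem : ∀ q′ W → ¬ HasKrIn G (suc (suc q′)) (_∈ W) → arcs (𝟙 W) (𝟙 W) ≤ 2 * turan (suc q′) ∣ W ∣
  turan-theorem q′ W = go W (⊂-wellFounded W)
    where
    q : ℕ
    q = suc q′
    go : ∀ W → Acc _⊂_ W → ¬ HasKrIn G (suc q) (_∈ W) → arcs (𝟙 W) (𝟙 W) ≤ 2 * turan q ∣ W ∣
    go W (acc smaller) noKr with nonempty? W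
    ... | no  W≡∅ = ≤-trans (≤-reflexive (arcs-Empty (𝟙 W) W≡∅)) z≤n
    ... | yes (v , v∈W) with maxClique W
    ...   | Q , maxQ@(clQ , Q⊆W , _) = +-cancelʳ-≤ (2 * t′) _ _ (begin
      A + 2 * t′                                          ≤⟨ +-monoˡ-≤ (2 * t′) (m≤m+n A _) ⟩
      A + 2 * ((∣ Q ∣ ∸ q) * ∣ ⊥ {n} ∣) + 2 * t′         ≤⟨ arcs-peel q′ maxQ ⊥⊆ (λ (_ , _ , _ , _ , _ , u∈⊥) → ∉⊥ u∈⊥) ⟩
      A′ + 2 * turan q ∣ W ∣ + 2 * B                     ≡⟨ cong (λ c → A′ + 2 * turan q ∣ W ∣ + 2 * ∑[ j < c ] ((∣ W ─ Q ∣ + toℕ j) / q + 1))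
                                                                 (m≤n⇒m∸n≡0 (clique-∣∣≤ noKr clQ Q⊆W)) ⟩
      A′ + 2 * turan q ∣ W ∣ + 0                         ≤⟨ +-monoˡ-≤ 0 (+-monoˡ-≤ (2 * turan q ∣ W ∣) IH) ⟩
      2 * t′ + 2 * turan q ∣ W ∣ + 0                     ≡⟨ rearrange (2 * t′) (2 * turan q ∣ W ∣) ⟩
      2 * turan q ∣ W ∣ + 2 * t′                         ∎)
      where
      open ≤-Reasoning
      A A′ t′ B : ℕ
      A = arcs (𝟙 W) (𝟙 W)
      A′ = arcs (𝟙 (W ─ Q)) (𝟙 (W ─ Q))
      t′ = turan q ∣ W ─ Q ∣
      B = ∑[ j < ∣ Q ∣ ∸ q ] ((∣ W ─ Q ∣ + toℕ j) / q + 1)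
      rearrange : ∀ a b → a + b + 0 ≡ b + a
      rearrange = solve-∀
      IH : A′ ≤ 2 * t′
      IH = go (W ─ Q) (smaller (p∩q≢∅⇒p─q⊂p W Q (maxClique-meets maxQ v∈W))) (noKr ∘ HasKrIn-mono (p─q⊆p W Q))

-- The deficit

-- In deficitFloors
-- the number N of vertices still present is separate from the ambient n, so that the parts
-- can be removed one at a time (deficitFloors-peel).
deficitTerms : ∀ {n k} → ℕ → (Fin k → Subset n) → ℕ
deficitTerms {k = k} r P = ∑[ i < k ] suc (∣ P i ∣ ∸ r)

deficitFloors : ∀ {n k} → ℕ → ℕ → (Fin k → Subset n) → ℕ
deficitFloors {k = k} N r P =
  ∑[ i < k ] ∑[ j < suc (∣ P i ∣ ∸ r) ] (fdiv (N ∸ (totalSize P ∸ toℕ j ∸ tailSize P i)) (r ∸ 1) + 1)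

module _ {n k : ℕ} where

  totalSize-∑ : (P : Fin k → Subset n) → totalSize P ≡ ∑[ l < k ] ∣ P l ∣
  totalSize-∑ P = sum-map-allFin (λ l → ∣ P l ∣)

  tailSize-∑ : (P : Fin k → Subset n) (i : Fin k) →
               tailSize P i ≡ ∑[ l < k ] (if toℕ i <ᵇ toℕ l then ∣ P l ∣ else 0)
  tailSize-∑ P i = sum-map-allFin (λ l → if toℕ i <ᵇ toℕ l then ∣ P l ∣ else 0)

module _ {n k : ℕ} (P : Fin (suc k) → Subset n) where

  totalSize-suc : totalSize P ≡ ∣ P zero ∣ + totalSize (P ∘ suc)
  totalSize-suc = trans (totalSize-∑ P) (cong (∣ P zero ∣ +_) (sym (totalSize-∑ (P ∘ suc))))

  tailSize-zero : tailSize P zero ≡ totalSize (P ∘ suc)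
  tailSize-zero = trans (tailSize-∑ P zero) (sym (totalSize-∑ (P ∘ suc)))

  tailSize-suc : ∀ i → tailSize P (suc i) ≡ tailSize (P ∘ suc) i
  tailSize-suc i = trans (tailSize-∑ P (suc i)) (sym (tailSize-∑ (P ∘ suc) i))

tailSize+∣Pi∣≤totalSize : ∀ {n k} (P : Fin k → Subset n) i → tailSize P i + ∣ P i ∣ ≤ totalSize P
tailSize+∣Pi∣≤totalSize P zero = ≤-reflexive (begin
  tailSize P zero + ∣ P zero ∣                ≡⟨ cong (_+ ∣ P zero ∣) (tailSize-zero P) ⟩
  totalSize (P ∘ suc) + ∣ P zero ∣            ≡⟨ +-comm _ ∣ P zero ∣ ⟩
  ∣ P zero ∣ + totalSize (P ∘ suc)            ≡⟨ totalSize-suc P ⟨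
  totalSize P                                 ∎)
  where open ≡-Reasoning
tailSize+∣Pi∣≤totalSize P (suc i) = begin
  tailSize P (suc i) + ∣ P (suc i) ∣          ≡⟨ cong (_+ ∣ P (suc i) ∣) (tailSize-suc P i) ⟩
  tailSize (P ∘ suc) i + ∣ P (suc i) ∣        ≤⟨ tailSize+∣Pi∣≤totalSize (P ∘ suc) i ⟩
  totalSize (P ∘ suc)                         ≤⟨ m≤n+m _ ∣ P zero ∣ ⟩
  ∣ P zero ∣ + totalSize (P ∘ suc)            ≡⟨ totalSize-suc P ⟨
  totalSize P                                 ∎
  where open ≤-Reasoning

deficitFloors-peel : ∀ {n k} N r (P : Fin (suc k) → Subset n) → ∣ P zero ∣ ≤ N →
  deficitFloors N r P ≡ ∑[ j < suc (∣ P zero ∣ ∸ r) ] (fdiv (N ∸ ∣ P zero ∣ + toℕ j) (r ∸ 1) + 1)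
                        + deficitFloors (N ∸ ∣ P zero ∣) r (P ∘ suc)
deficitFloors-peel {k = k} N r P s≤N =
  cong₂ _+_ (sum-cong-≗ {suc (s ∸ r)} (λ j → cong floor+1 (first-part (j≤∣Pi∣ zero j))))
            (sum-cong-≗ {k} (λ i → sum-cong-≗ {suc (∣ P (suc i) ∣ ∸ r)} (λ j → cong floor+1 (later-part i (j≤∣Pi∣ (suc i) j)))))
  where
  s T′ : ℕ
  s = ∣ P zero ∣
  T′ = totalSize (P ∘ suc)
  floor+1 : ℕ → ℕ
  floor+1 x = fdiv x (r ∸ 1) + 1
  j≤∣Pi∣ : ∀ i (j : Fin (suc (∣ P i ∣ ∸ r))) → toℕ j ≤ ∣ P i ∣
  j≤∣Pi∣ i j = ≤-trans (s≤s⁻¹ (toℕ<n j)) (m∸n≤m _ r)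
  first-part : ∀ {j} → j ≤ s → N ∸ (totalSize P ∸ j ∸ tailSize P zero) ≡ N ∸ s + j
  first-part {j} j≤s = begin
    N ∸ (totalSize P ∸ j ∸ tailSize P zero)    ≡⟨ cong₂ (λ t u → N ∸ (t ∸ j ∸ u)) (totalSize-suc P) (tailSize-zero P) ⟩
    N ∸ (s + T′ ∸ j ∸ T′)                       ≡⟨ cong (λ x → N ∸ (x ∸ T′)) (+-∸-comm T′ j≤s) ⟩
    N ∸ (s ∸ j + T′ ∸ T′)                       ≡⟨ cong (N ∸_) (m+n∸n≡m (s ∸ j) T′) ⟩
    N ∸ (s ∸ j)                                 ≡⟨ cong (_∸ (s ∸ j)) (sym N≡) ⟩
    N ∸ s + j + (s ∸ j) ∸ (s ∸ j)               ≡⟨ m+n∸n≡m (N ∸ s + j) (s ∸ j) ⟩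
    N ∸ s + j                                   ∎
    where
    open ≡-Reasoning
    N≡ : N ∸ s + j + (s ∸ j) ≡ N
    N≡ = trans (+-assoc (N ∸ s) j (s ∸ j)) (trans (cong (N ∸ s +_) (m+[n∸m]≡n j≤s)) (m∸n+n≡m s≤N))
  later-part : ∀ i {j} → j ≤ ∣ P (suc i) ∣ →
               N ∸ (totalSize P ∸ j ∸ tailSize P (suc i)) ≡ N ∸ s ∸ (T′ ∸ j ∸ tailSize (P ∘ suc) i)
  later-part i {j} j≤ = begin
    N ∸ (totalSize P ∸ j ∸ tailSize P (suc i))  ≡⟨ cong₂ (λ t u → N ∸ (t ∸ j ∸ u)) (totalSize-suc P) (tailSize-suc P i) ⟩
    N ∸ (s + T′ ∸ j ∸ t)                         ≡⟨ cong (λ x → N ∸ (x ∸ t)) (+-∸-assoc s j≤T′) ⟩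
    N ∸ (s + (T′ ∸ j) ∸ t)                       ≡⟨ cong (N ∸_) (+-∸-assoc s t≤T′∸j) ⟩
    N ∸ (s + (T′ ∸ j ∸ t))                       ≡⟨ ∸-+-assoc N s _ ⟨
    N ∸ s ∸ (T′ ∸ j ∸ t)                         ∎
    where
    open ≡-Reasoning
    t : ℕ
    t = tailSize (P ∘ suc) i
    t+j≤T′ : t + j ≤ T′
    t+j≤T′ = ≤-trans (+-monoʳ-≤ t j≤) (tailSize+∣Pi∣≤totalSize (P ∘ suc) i)
    j≤T′ : j ≤ T′
    j≤T′ = ≤-trans (m≤n+m j t) t+j≤T′
    t≤T′∸j : t ≤ T′ ∸ j
    t≤T′∸j = ≤-trans (≤-reflexive (sym (m+n∸n≡m t j))) (∸-monoˡ-≤ j t+j≤T′)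

foldr-⊖ : ∀ {A : Set} (xs : List A) {h : A → ℤ} (f g : A → ℕ) → (∀ x → h x ≡ ℤ.+ f x ℤ.- ℤ.+ g x) →
  List.foldr ℤ._+_ (ℤ.+ 0) (map h xs) ≡ ℤ.+ sumᴸ (map f xs) ℤ.- ℤ.+ sumᴸ (map g xs)
foldr-⊖ List.[]       f g h≗ = refl
foldr-⊖ (x List.∷ xs) {h} f g h≗ = begin
  h x ℤ.+ List.foldr ℤ._+_ (ℤ.+ 0) (map h xs)             ≡⟨ cong₂ ℤ._+_ (h≗ x) (foldr-⊖ xs f g h≗) ⟩
  (ℤ.+ f x ℤ.- ℤ.+ g x) ℤ.+ (ℤ.+ F ℤ.- ℤ.+ G)             ≡⟨ regroup (ℤ.+ f x) (ℤ.+ g x) (ℤ.+ F) (ℤ.+ G) ⟩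
  (ℤ.+ f x ℤ.+ ℤ.+ F) ℤ.- (ℤ.+ g x ℤ.+ ℤ.+ G)             ≡⟨ cong₂ ℤ._-_ (pos-+ (f x) F) (pos-+ (g x) G) ⟨
  ℤ.+ (f x + F) ℤ.- ℤ.+ (g x + G)                         ∎
  where
  open ≡-Reasoning
  F G : ℕ
  F = sumᴸ (map f xs)
  G = sumᴸ (map g xs)
  regroup : ∀ a b c d → (a ℤ.- b) ℤ.+ (c ℤ.- d) ≡ (a ℤ.+ c) ℤ.- (b ℤ.+ d)
  regroup = ℤ-Solver.solve-∀

deficit-≡ : ∀ {n k} m r (P : Fin k → Subset n) →
  deficit n m r k P ≡ ℤ.+ (m * deficitTerms r P) ℤ.- ℤ.+ deficitFloors n r P
deficit-≡ {n} {k} m r P = begin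
  deficit n m r k P
    ≡⟨ foldr-⊖ (allFin k) (λ i → sumᴸ (map (λ _ → m) (block i))) (λ i → sumᴸ (map (floor+1 i) (block i)))
         (λ i → foldr-⊖ (block i) (λ _ → m) (floor+1 i) (λ j → regroup (ℤ.+ m) (ℤ.+ floor i j))) ⟩
  ℤ.+ sumᴸ (map (λ i → sumᴸ (map (λ _ → m) (block i))) (allFin k))
    ℤ.- ℤ.+ sumᴸ (map (λ i → sumᴸ (map (floor+1 i) (block i))) (allFin k))
    ≡⟨ cong₂ (λ a b → ℤ.+ a ℤ.- ℤ.+ b) terms floors ⟩
  ℤ.+ (m * deficitTerms r P) ℤ.- ℤ.+ deficitFloors n r P
    ∎
  where
  open ≡-Reasoning
  c : Fin k → ℕ
  c i = suc (∣ P i ∣ ∸ r)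
  block : Fin k → List ℕ
  block i = upTo (c i)
  floor floor+1 : Fin k → ℕ → ℕ
  floor i j = fdiv (n ∸ (totalSize P ∸ j ∸ tailSize P i)) (r ∸ 1)
  floor+1 i j = floor i j + 1
  regroup : ∀ a b → (a ℤ.- b) ℤ.- ℤ.+ 1 ≡ a ℤ.- (b ℤ.+ ℤ.+ 1)
  regroup = ℤ-Solver.solve-∀
  terms : sumᴸ (map (λ i → sumᴸ (map (λ _ → m) (block i))) (allFin k)) ≡ m * deficitTerms r P
  terms = begin
    sumᴸ (map (λ i → sumᴸ (map (λ _ → m) (block i))) (allFin k))   ≡⟨ sum-map-allFin (λ i → sumᴸ (map (λ _ → m) (block i))) ⟩
    ∑[ i < k ] sumᴸ (map (λ _ → m) (block i))                       ≡⟨ sum-cong-≗ {k} (λ i → sum-map-applyUpTo (λ _ → m) (λ j → j) (c i)) ⟩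
    ∑[ i < k ] ∑[ j < c i ] m                                       ≡⟨ sum-cong-≗ {k} (λ i → trans (∑-const (c i) m) (*-comm (c i) m)) ⟩
    ∑[ i < k ] (m * c i)                                            ≡⟨ *-distribˡ-sum m c ⟨
    m * deficitTerms r P                                            ∎
  floors : sumᴸ (map (λ i → sumᴸ (map (floor+1 i) (block i))) (allFin k)) ≡ deficitFloors n r P
  floors = trans (sum-map-allFin (λ i → sumᴸ (map (floor+1 i) (block i))))
                 (sum-cong-≗ {k} (λ i → sum-map-applyUpTo (floor+1 i) (λ j → j) (c i)))

-- Peeling off the maximum cliques

module _ {n : ℕ} (G : Graph n) (q′ : ℕ) {M : Subset n} (noKr : ¬ KrMeets G (suc (suc q′)) M) where
  private
    q r : ℕ
    q = suc q′
    r = suc q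

  peeling-bound : ∀ {k} W (P : Fin k → Subset n) → M ⊆ W → (∀ i → r ≤ ∣ P i ∣) →
    (∀ i → IsMaxCliqueIn G (λ v → v ∈ W × NotInEarlier P i v) (P i)) →
    ¬ HasKrIn G r (λ v → v ∈ W × NotInAny P v) →
    arcs G (𝟙 W) (𝟙 W) + 2 * (∣ M ∣ * deficitTerms r P) ≤ 2 * turan q ∣ W ∣ + 2 * deficitFloors ∣ W ∣ r P
  peeling-bound {zero} W P _ _ _ noKrW = begin
    arcs G (𝟙 W) (𝟙 W) + 2 * (∣ M ∣ * 0)     ≡⟨ cong (λ x → arcs G (𝟙 W) (𝟙 W) + 2 * x) (*-zeroʳ ∣ M ∣) ⟩
    arcs G (𝟙 W) (𝟙 W) + 0                   ≡⟨ +-identityʳ _ ⟩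
    arcs G (𝟙 W) (𝟙 W)                       ≤⟨ turan-theorem G q′ W (noKrW ∘ HasKrIn-mono G (λ v∈W → v∈W , λ ())) ⟩
    2 * turan q ∣ W ∣                         ≡⟨ +-identityʳ _ ⟨
    2 * turan q ∣ W ∣ + 0                     ∎
    where open ≤-Reasoning
  peeling-bound {suc k} W P M⊆W r≤∣P∣ maxP noKrW = +-cancelʳ-≤ (A′ + 2 * t′) _ _ (begin
    A + 2 * (m * (suc (s ∸ r) + c′)) + (A′ + 2 * t′)     ≡⟨ cong (λ c → A + 2 * (m * (c + c′)) + (A′ + 2 * t′)) suc[s∸r]≡s∸q ⟩
    A + 2 * (m * (s ∸ q + c′)) + (A′ + 2 * t′)           ≡⟨ regroup A m (s ∸ q) c′ A′ t′ ⟩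
    (A + 2 * ((s ∸ q) * m) + 2 * t′) + (A′ + 2 * (m * c′))
                                                          ≤⟨ +-mono-≤ (arcs-peel G q′ maxQ M⊆W─Q noKr) IH ⟩
    (A′ + 2 * t + 2 * B) + (2 * t′ + 2 * F′)             ≡⟨ regroup′ A′ t B t′ F′ ⟩
    2 * t + 2 * (B + F′) + (A′ + 2 * t′)                 ≡⟨ cong (λ x → 2 * t + 2 * x + (A′ + 2 * t′)) floors ⟨
    2 * t + 2 * deficitFloors ∣ W ∣ r P + (A′ + 2 * t′)  ∎)
    where
    open ≤-Reasoning
    Q : Subset n
    Q = P zero
    P′ : Fin k → Subset n
    P′ = P ∘ suc
    s m c′ N′ A A′ t t′ B F′ : ℕ
    s = ∣ Q ∣
    m = ∣ M ∣
    c′ = deficitTerms r P′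
    N′ = ∣ W ─ Q ∣
    A = arcs G (𝟙 W) (𝟙 W)
    A′ = arcs G (𝟙 (W ─ Q)) (𝟙 (W ─ Q))
    t = turan q ∣ W ∣
    t′ = turan q N′
    B = ∑[ j < s ∸ q ] ((N′ + toℕ j) / q + 1)
    F′ = deficitFloors N′ r P′
    maxQ : IsMaxCliqueIn G (_∈ W) Q
    maxQ = IsMaxCliqueIn-resp G proj₁ (λ v∈W → v∈W , λ _ ()) (maxP zero)
    Q⊆W : Q ⊆ W
    Q⊆W = proj₁ (proj₂ maxQ) _
    M⊆W─Q : M ⊆ W ─ Q
    M⊆W─Q u∈M = x∈p∧x∉q⇒x∈p─q (M⊆W u∈M) (∉-large-clique G noKr (proj₁ maxQ) (r≤∣P∣ zero) u∈M)
    later-region : ∀ i {v} → v ∈ W × NotInEarlier P (suc i) v → v ∈ W ─ Q × NotInEarlier P′ i v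
    later-region i (v∈W , ∉earlier) = x∈p∧x∉q⇒x∈p─q v∈W (∉earlier zero z<s) , λ j j<i → ∉earlier (suc j) (s<s j<i)
    later-region⁻¹ : ∀ i {v} → v ∈ W ─ Q × NotInEarlier P′ i v → v ∈ W × NotInEarlier P (suc i) v
    later-region⁻¹ i (v∈W─Q , ∉earlier) = p─q⊆p W Q v∈W─Q , λ where
      zero    _         → x∈p─q⇒x∉q v∈W─Q
      (suc j) (s<s j<i) → ∉earlier j j<i
    IH : A′ + 2 * (m * c′) ≤ 2 * t′ + 2 * F′
    IH = peeling-bound (W ─ Q) P′ M⊆W─Q (r≤∣P∣ ∘ suc)
      (λ i → IsMaxCliqueIn-resp G (later-region i) (later-region⁻¹ i) (maxP (suc i)))
      (noKrW ∘ HasKrIn-mono G λ (v∈W─Q , ∉P′) → p─q⊆p W Q v∈W─Q , λ { zero → x∈p─q⇒x∉q v∈W─Q ; (suc j) → ∉P′ j })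
    suc[s∸r]≡s∸q : suc (s ∸ r) ≡ s ∸ q
    suc[s∸r]≡s∸q = sym (+-∸-assoc 1 (r≤∣P∣ zero))
    ∣W∣∸s≡N′ : ∣ W ∣ ∸ s ≡ N′
    ∣W∣∸s≡N′ = trans (cong (_∸ s) (∣p∣≡∣q∣+∣p─q∣ Q⊆W)) (m+n∸m≡n s N′)
    floors : deficitFloors ∣ W ∣ r P ≡ B + F′
    floors = trans (deficitFloors-peel ∣ W ∣ r P (p⊆q⇒∣p∣≤∣q∣ Q⊆W))
      (cong₂ (λ c N → ∑[ j < c ] ((N + toℕ j) / q + 1) + deficitFloors N r P′) suc[s∸r]≡s∸q ∣W∣∸s≡N′)
    regroup : ∀ a m c c′ a′ t′ → a + 2 * (m * (c + c′)) + (a′ + 2 * t′) ≡ (a + 2 * (c * m) + 2 * t′) + (a′ + 2 * (m * c′))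
    regroup = solve-∀
    regroup′ : ∀ a′ t b t′ f′ → (a′ + 2 * t + 2 * b) + (2 * t′ + 2 * f′) ≡ 2 * t + 2 * (b + f′) + (a′ + 2 * t′)
    regroup′ = solve-∀

  edge-bound : ∀ {k} (P : Fin k → Subset n) → (∀ i → r ≤ ∣ P i ∣) →
    (∀ i → IsMaxCliqueIn G (NotInEarlier P i) (P i)) → ¬ HasKrIn G r (NotInAny P) →
    e G + ∣ M ∣ * deficitTerms r P ≤ turan q n + deficitFloors n r P
  edge-bound P r≤∣P∣ maxP noKrP = *-cancelˡ-≤ 2 (begin
    2 * (e G + m * T)                                  ≡⟨ *-distribˡ-+ 2 (e G) (m * T) ⟩
    2 * e G + 2 * (m * T)                              ≡⟨ cong (_+ 2 * (m * T)) (arcs-⊤ G) ⟨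
    arcs G (𝟙 ⊤) (𝟙 ⊤) + 2 * (m * T)                  ≤⟨ peeling-bound ⊤ P ⊆⊤ r≤∣P∣ maxP⊤ noKr⊤ ⟩
    2 * turan q ∣ ⊤ {n} ∣ + 2 * deficitFloors ∣ ⊤ {n} ∣ r P
                                                       ≡⟨ cong (λ N → 2 * turan q N + 2 * deficitFloors N r P) (∣⊤∣≡n n) ⟩
    2 * turan q n + 2 * deficitFloors n r P            ≡⟨ *-distribˡ-+ 2 (turan q n) _ ⟨
    2 * (turan q n + deficitFloors n r P)              ∎)
    where
    open ≤-Reasoning
    m T : ℕ
    m = ∣ M ∣
    T = deficitTerms r P
    maxP⊤ : ∀ i → IsMaxCliqueIn G (λ v → v ∈ ⊤ × NotInEarlier P i v) (P i)
    maxP⊤ i = IsMaxCliqueIn-resp G (∈⊤ ,_) proj₂ (maxP i)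
    noKr⊤ : ¬ HasKrIn G r (λ v → v ∈ ⊤ × NotInAny P v)
    noKr⊤ = noKrP ∘ HasKrIn-mono G proj₂

ℤ-bound : ∀ {e a t b} → e + a ≤ t + b → ℤ.+ e ℤ.≤ ℤ.+ t ℤ.- (ℤ.+ a ℤ.- ℤ.+ b)
ℤ-bound {e} {a} {t} {b} e+a≤t+b = begin
  ℤ.+ e                                  ≡⟨ regroup (ℤ.+ e) (ℤ.+ a) ⟩
  ℤ.+ e ℤ.+ ℤ.+ a ℤ.- ℤ.+ a              ≡⟨ cong (ℤ._- ℤ.+ a) (pos-+ e a) ⟨
  ℤ.+ (e + a) ℤ.- ℤ.+ a                  ≤⟨ ℤ.+-monoˡ-≤ (ℤ.- ℤ.+ a) (ℤ.+≤+ e+a≤t+b) ⟩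
  ℤ.+ (t + b) ℤ.- ℤ.+ a                  ≡⟨ cong (ℤ._- ℤ.+ a) (pos-+ t b) ⟩
  ℤ.+ t ℤ.+ ℤ.+ b ℤ.- ℤ.+ a              ≡⟨ regroup′ (ℤ.+ t) (ℤ.+ a) (ℤ.+ b) ⟩
  ℤ.+ t ℤ.- (ℤ.+ a ℤ.- ℤ.+ b)            ∎
  where
  open ℤ.≤-Reasoning
  regroup : ∀ x y → x ≡ x ℤ.+ y ℤ.- y
  regroup = ℤ-Solver.solve-∀
  regroup′ : ∀ x y z → x ℤ.+ z ℤ.- y ≡ x ℤ.- (y ℤ.- z)
  regroup′ = ℤ-Solver.solve-∀

open import Data.Integer using (+_; _-_) renaming (_≤_ to _≤ℤ_)

lemma2p1 : (r m n k : ℕ) → 3 ≤ r → n ≤ (r ∸ 1) * m →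
    (G : Graph n) → (M : Subset n) → ∣ M ∣ ≡ m → ¬ KrMeets G r M →
    (P : Fin k → Subset n) →
    (∀ i → r ≤ ∣ P i ∣) →
    (∀ i → IsMaxCliqueIn G (NotInEarlier P i) (P i)) →
    ¬ HasKrIn G r (NotInAny P) →
    (+ e G) ≤ℤ ((+ turan (r ∸ 1) n) - deficit n m r k P)
lemma2p1 r@(suc (suc (suc q″))) m n k (s≤s (s≤s (s≤s _))) _ G M refl noKr P r≤∣P∣ maxP noKrP =
  subst (λ d → + e G ≤ℤ + turan (r ∸ 1) n - d) (sym (deficit-≡ m r P))
        (ℤ-bound {t = turan (r ∸ 1) n} {b = deficitFloors n r P} (edge-bound G (suc q″) noKr P r≤∣P∣ maxP noKrP))
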